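{- Let $\mathfrak{t}=1+i$ and let $\alpha\in\mathbb{Z}[i]$ be primary, i.e. $\alpha\equiv1\pmod{\mathfrak{t}^3}$. There is a unique pair $(m_\alpha,n_\alpha)\in(\mathbb{Z}/4\mathbb{Z})^2$ with $\alpha\equiv(1-4i)^{m_\alpha}(-1-6i)^{n_\alpha}\pmod{\mathfrak{t}^7}$. Write $m_\alpha=m_0+2m_1$ and $n_\alpha=n_0+2n_1$ with $m_0,m_1,n_0,n_1\in\{0,1\}$. Then $$\alpha\equiv1+n_0\mathfrak{t}^3+m_0\mathfrak{t}^4+(m_0+n_1)\mathfrak{t}^5+(m_0+n_0+m_1)\mathfrak{t}^6\pmod{\mathfrak{t}^7}.$$ -}

module Defs where

open import Data.Nat as ℕ using (ℕ; zero; suc)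
open import Data.Nat.DivMod using (_%_; _/_)
open import Data.Integer as ℤ using (ℤ; +_; -[1+_])
open import Data.Fin using (Fin; toℕ)
open import Data.Product using (Σ; ∃; _×_; _,_)
open import Relation.Binary.PropositionalEquality using (_≡_)

record ℤ[i] : Set where
  constructor _+_i
  field
    re : ℤ
    im : ℤ
open ℤ[i] public

infixl 6 _+ᵍ_ _-ᵍ_
infixl 7 _*ᵍ_
infixr 8 _^ᵍ_

_+ᵍ_ : ℤ[i] → ℤ[i] → ℤ[i]
(a + b i) +ᵍ (c + d i) = (a ℤ.+ c) + (b ℤ.+ d) i

-ᵍ_ : ℤ[i] → ℤ[i]
-ᵍ (a + b i) = (ℤ.- a) + (ℤ.- b) i

_-ᵍ_ : ℤ[i] → ℤ[i] → ℤ[i]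
x -ᵍ y = x +ᵍ (-ᵍ y)

_*ᵍ_ : ℤ[i] → ℤ[i] → ℤ[i]
(a + b i) *ᵍ (c + d i) = (a ℤ.* c ℤ.- b ℤ.* d) + (a ℤ.* d ℤ.+ b ℤ.* c) i

1ᵍ : ℤ[i]
1ᵍ = (+ 1) + (+ 0) i

ℕ→ℤ[i] : ℕ → ℤ[i]
ℕ→ℤ[i] n = (+ n) + (+ 0) i

_^ᵍ_ : ℤ[i] → ℕ → ℤ[i]
x ^ᵍ zero = 1ᵍ
x ^ᵍ suc n = x *ᵍ (x ^ᵍ n)

_∣ᵍ_ : ℤ[i] → ℤ[i] → Set
a ∣ᵍ b = ∃ λ c → b ≡ a *ᵍ c

_≡_[modᵍ_] : ℤ[i] → ℤ[i] → ℤ[i] → Set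
x ≡ y [modᵍ γ ] = γ ∣ᵍ (x -ᵍ y)

𝔱 : ℤ[i]
𝔱 = (+ 1) + (+ 1) i

Primary : ℤ[i] → Set
Primary α = α ≡ 1ᵍ [modᵍ 𝔱 ^ᵍ 3 ]

u₁ : ℤ[i]
u₁ = (+ 1) + (ℤ.- (+ 4)) i

u₂ : ℤ[i]
u₂ = (ℤ.- (+ 1)) + (ℤ.- (+ 6)) i

-- the defining congruence for (m_α, n_α) ∈ (ℤ/4ℤ)², represented by Fin 4
-- (well defined since u₁, u₂ have order dividing 4 mod 𝔱⁷; we use the
-- representatives 0..3)
Rep : ℤ[i] → Fin 4 → Fin 4 → Set
Rep α m n = α ≡ (u₁ ^ᵍ toℕ m) *ᵍ (u₂ ^ᵍ toℕ n) [modᵍ 𝔱 ^ᵍ 7 ]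

bit₀ bit₁ : Fin 4 → ℕ
bit₀ k = toℕ k % 2
bit₁ k = toℕ k / 2

expansion : Fin 4 → Fin 4 → ℤ[i]
expansion m n =
  1ᵍ +ᵍ ℕ→ℤ[i] (bit₀ n) *ᵍ 𝔱 ^ᵍ 3
     +ᵍ ℕ→ℤ[i] (bit₀ m) *ᵍ 𝔱 ^ᵍ 4
     +ᵍ ℕ→ℤ[i] (bit₀ m ℕ.+ bit₁ n) *ᵍ 𝔱 ^ᵍ 5
     +ᵍ ℕ→ℤ[i] (bit₀ m ℕ.+ bit₀ n ℕ.+ bit₁ m) *ᵍ 𝔱 ^ᵍ 6

{-# OPTIONS --safe #-}
module Submission where

open import Defs
open import Level using (0ℓ)
open import Data.Nat as ℕ using ()
open import Data.Integer as ℤ using (ℤ; +_; _/ℕ_)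
open import Data.Integer.DivMod using (n%ℕd<d; a≡a%ℕn+[a/ℕn]*n)
open import Data.Integer.Divisibility.Signed using (_∣_; divides; _∣?_)
open import Data.Integer.Tactic.RingSolver using (solve-∀)
open import Data.Fin using (Fin; toℕ; fromℕ<)
open import Data.Fin.Properties using (all?; any?; toℕ-fromℕ<; _≟_)
open import Data.Product using (Σ; ∃₂; _×_; _,_)
open import Data.Unit using (tt)
open import Relation.Binary.Bundles using (Setoid)
open import Relation.Binary.PropositionalEquality using (_≡_; refl; sym; trans; cong; cong₂)
open import Relation.Nullary using (Dec)
open import Relation.Nullary.Decidable using (map′; toWitness; _×-dec_; _→-dec_)
import Relation.Binary.Reasoning.Setoid as SetoidReasoning

-- Since 𝔱⁴ = -4, a primary α = 1 + 𝔱³w is determined modulo 𝔱⁷ by w modulo 4, so there are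
-- sixteen primary classes modulo 𝔱⁷. Divisibility by 𝔱⁷ = 8 - 8i is decidable (a + bi is
-- divisible iff 8 ∣ a and 16 ∣ a + b), and what remains are finite computations over these
-- classes: each contains a monomial (1-4i)^m (-1-6i)^n, the sixteen monomials are pairwise
-- incongruent, and each monomial is congruent to its expansion.

-- Identities in ℤ[i] are proved componentwise, each component being stated in exactly the
-- form to which the operations of ℤ[i] unfold.
≡[modᵍ]-setoid : ℤ[i] → Setoid 0ℓ 0ℓ
≡[modᵍ]-setoid γ@(g + h i) = record
  { Carrier       = ℤ[i]
  ; _≈_           = _≡_[modᵍ γ ]
  ; isEquivalence = record
    { refl  = λ {x} → ℕ→ℤ[i] 0 , x-x≡γ*0 x
    ; sym   = λ {x} {y} (c , x-y≡γc) →
        -ᵍ c , trans (y-x≡-[x-y] x y) (trans (cong -ᵍ_ x-y≡γc) (-[γ*c]≡γ*-c c))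
    ; trans = λ {x} {y} {z} (c , x-y≡γc) (d , y-z≡γd) →
        c +ᵍ d , trans (x-z≡[x-y]+[y-z] x y z)
                       (trans (cong₂ _+ᵍ_ x-y≡γc y-z≡γd) (γ*c+γ*d≡γ*[c+d] c d))
    }
  }
  where
  x-x≡γ*0 : ∀ x → x -ᵍ x ≡ γ *ᵍ ℕ→ℤ[i] 0
  x-x≡γ*0 (a + b i) = cong₂ _+_i (re-eq a g h) (im-eq b g h)
    where
    re-eq : ∀ a g h → a ℤ.- a ≡ g ℤ.* + 0 ℤ.- h ℤ.* + 0
    re-eq = solve-∀
    im-eq : ∀ b g h → b ℤ.- b ≡ g ℤ.* + 0 ℤ.+ h ℤ.* + 0
    im-eq = solve-∀

  y-x≡-[x-y] : ∀ x y → y -ᵍ x ≡ -ᵍ (x -ᵍ y)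
  y-x≡-[x-y] (a + b i) (c + d i) = cong₂ _+_i (eq a c) (eq b d)
    where
    eq : ∀ a c → c ℤ.- a ≡ ℤ.- (a ℤ.- c)
    eq = solve-∀

  -[γ*c]≡γ*-c : ∀ c → -ᵍ (γ *ᵍ c) ≡ γ *ᵍ (-ᵍ c)
  -[γ*c]≡γ*-c (p + q i) = cong₂ _+_i (re-eq g h p q) (im-eq g h p q)
    where
    re-eq : ∀ g h p q → ℤ.- (g ℤ.* p ℤ.- h ℤ.* q) ≡ g ℤ.* ℤ.- p ℤ.- h ℤ.* ℤ.- q
    re-eq = solve-∀
    im-eq : ∀ g h p q → ℤ.- (g ℤ.* q ℤ.+ h ℤ.* p) ≡ g ℤ.* ℤ.- q ℤ.+ h ℤ.* ℤ.- p
    im-eq = solve-∀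

  x-z≡[x-y]+[y-z] : ∀ x y z → x -ᵍ z ≡ (x -ᵍ y) +ᵍ (y -ᵍ z)
  x-z≡[x-y]+[y-z] (a + b i) (c + d i) (e + f i) = cong₂ _+_i (eq a c e) (eq b d f)
    where
    eq : ∀ a c e → a ℤ.- e ≡ (a ℤ.- c) ℤ.+ (c ℤ.- e)
    eq = solve-∀

  γ*c+γ*d≡γ*[c+d] : ∀ c d → γ *ᵍ c +ᵍ γ *ᵍ d ≡ γ *ᵍ (c +ᵍ d)
  γ*c+γ*d≡γ*[c+d] (p + q i) (r + s i) = cong₂ _+_i (re-eq g h p q r s) (im-eq g h p q r s)
    where
    re-eq : ∀ g h p q r s →
      (g ℤ.* p ℤ.- h ℤ.* q) ℤ.+ (g ℤ.* r ℤ.- h ℤ.* s) ≡ g ℤ.* (p ℤ.+ r) ℤ.- h ℤ.* (q ℤ.+ s)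
    re-eq = solve-∀
    im-eq : ∀ g h p q r s →
      (g ℤ.* q ℤ.+ h ℤ.* p) ℤ.+ (g ℤ.* s ℤ.+ h ℤ.* r) ≡ g ℤ.* (q ℤ.+ s) ℤ.+ h ℤ.* (p ℤ.+ r)
    im-eq = solve-∀

𝔱⁷∣ᵍ⇒ : ∀ {a b} → (𝔱 ^ᵍ 7) ∣ᵍ (a + b i) → + 8 ∣ a × + 16 ∣ a ℤ.+ b
𝔱⁷∣ᵍ⇒ (x + y i , refl) = divides (x ℤ.+ y) (re-eq x y) , divides y (sum-eq x y)
  where
  re-eq : ∀ x y → + 8 ℤ.* x ℤ.- ℤ.- + 8 ℤ.* y ≡ (x ℤ.+ y) ℤ.* + 8
  re-eq = solve-∀
  sum-eq : ∀ x y → (+ 8 ℤ.* x ℤ.- ℤ.- + 8 ℤ.* y) ℤ.+ (+ 8 ℤ.* y ℤ.+ ℤ.- + 8 ℤ.* x) ≡ y ℤ.* + 16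
  sum-eq = solve-∀

𝔱⁷∣ᵍ⇐ : ∀ {a b} → + 8 ∣ a × + 16 ∣ a ℤ.+ b → (𝔱 ^ᵍ 7) ∣ᵍ (a + b i)
𝔱⁷∣ᵍ⇐ {b = b} (divides k refl , divides y a+b≡16y) =
  (k ℤ.- y) + y i ,
  cong₂ _+_i (re-eq k y)
             (trans (b≡[8k+b]-8k k b) (trans (cong (ℤ._- k ℤ.* + 8) a+b≡16y) (im-eq k y)))
  where
  re-eq : ∀ k y → k ℤ.* + 8 ≡ + 8 ℤ.* (k ℤ.- y) ℤ.- ℤ.- + 8 ℤ.* y
  re-eq = solve-∀
  b≡[8k+b]-8k : ∀ k b → b ≡ (k ℤ.* + 8 ℤ.+ b) ℤ.- k ℤ.* + 8
  b≡[8k+b]-8k = solve-∀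
  im-eq : ∀ k y → y ℤ.* + 16 ℤ.- k ℤ.* + 8 ≡ + 8 ℤ.* y ℤ.+ ℤ.- + 8 ℤ.* (k ℤ.- y)
  im-eq = solve-∀

_≡?_[mod𝔱⁷] : (x y : ℤ[i]) → Dec (x ≡ y [modᵍ 𝔱 ^ᵍ 7 ])
x ≡? y [mod𝔱⁷] =
  map′ 𝔱⁷∣ᵍ⇐ 𝔱⁷∣ᵍ⇒ (+ 8 ∣? re (x -ᵍ y) ×-dec + 16 ∣? re (x -ᵍ y) ℤ.+ im (x -ᵍ y))

x-y≡z⇒x≡y+z : ∀ x y {z} → x -ᵍ y ≡ z → x ≡ y +ᵍ z
x-y≡z⇒x≡y+z (a + b i) (c + d i) refl = cong₂ _+_i (eq a c) (eq b d)
  where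
  eq : ∀ a c → a ≡ c ℤ.+ (a ℤ.- c)
  eq = solve-∀

ℤ-divMod : ∀ x d .{{_ : ℕ.NonZero d}} → ∃₂ λ (r : Fin d) q → x ≡ + toℕ r ℤ.+ q ℤ.* + d
ℤ-divMod x d = fromℕ< (n%ℕd<d x d) , x /ℕ d ,
  trans (a≡a%ℕn+[a/ℕn]*n x d) (cong (λ r → + r ℤ.+ x /ℕ d ℤ.* + d) (sym (toℕ-fromℕ< (n%ℕd<d x d))))

-- 𝔱³ = -2 + 2i and 𝔱⁴ = -4, so 𝔱³ (4 qx + 4 qy i) = 𝔱⁷ (- qx - qy i).
𝔱³-shift : (x y qx qy : ℤ) →
  (1ᵍ +ᵍ 𝔱 ^ᵍ 3 *ᵍ ((x ℤ.+ qx ℤ.* + 4) + (y ℤ.+ qy ℤ.* + 4) i))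
    ≡ (1ᵍ +ᵍ 𝔱 ^ᵍ 3 *ᵍ (x + y i)) [modᵍ 𝔱 ^ᵍ 7 ]
𝔱³-shift x y qx qy = (ℤ.- qx) + (ℤ.- qy) i , cong₂ _+_i (re-eq x y qx qy) (im-eq x y qx qy)
  where
  re-eq : ∀ x y qx qy →
    (+ 1 ℤ.+ (ℤ.- + 2 ℤ.* (x ℤ.+ qx ℤ.* + 4) ℤ.- + 2 ℤ.* (y ℤ.+ qy ℤ.* + 4)))
      ℤ.- (+ 1 ℤ.+ (ℤ.- + 2 ℤ.* x ℤ.- + 2 ℤ.* y))
    ≡ + 8 ℤ.* ℤ.- qx ℤ.- ℤ.- + 8 ℤ.* ℤ.- qy
  re-eq = solve-∀
  im-eq : ∀ x y qx qy →
    (+ 0 ℤ.+ (ℤ.- + 2 ℤ.* (y ℤ.+ qy ℤ.* + 4) ℤ.+ + 2 ℤ.* (x ℤ.+ qx ℤ.* + 4)))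
      ℤ.- (+ 0 ℤ.+ (ℤ.- + 2 ℤ.* y ℤ.+ + 2 ℤ.* x))
    ≡ + 8 ℤ.* ℤ.- qy ℤ.+ ℤ.- + 8 ℤ.* ℤ.- qx
  im-eq = solve-∀

primaryResidue : Fin 4 → Fin 4 → ℤ[i]
primaryResidue f g = 1ᵍ +ᵍ 𝔱 ^ᵍ 3 *ᵍ ((+ toℕ f) + (+ toℕ g) i)

primary⇒≡primaryResidue : ∀ α → Primary α →
  ∃₂ λ f g → α ≡ primaryResidue f g [modᵍ 𝔱 ^ᵍ 7 ]
primary⇒≡primaryResidue α (x + y i , α-1≡𝔱³w) with x-y≡z⇒x≡y+z α 1ᵍ α-1≡𝔱³w
... | refl with ℤ-divMod x 4 | ℤ-divMod y 4
...   | f , qx , refl | g , qy , refl = f , g , 𝔱³-shift (+ toℕ f) (+ toℕ g) qx qy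

monomial : Fin 4 → Fin 4 → ℤ[i]
monomial m n = (u₁ ^ᵍ toℕ m) *ᵍ (u₂ ^ᵍ toℕ n)

primaryResidue-≡-monomial : ∀ f g → ∃₂ λ m n → primaryResidue f g ≡ monomial m n [modᵍ 𝔱 ^ᵍ 7 ]
primaryResidue-≡-monomial = toWitness {a? = all? λ f → all? λ g → any? λ m → any? λ n →
  primaryResidue f g ≡? monomial m n [mod𝔱⁷]} tt

monomial-injective : ∀ m n m′ n′ →
  monomial m n ≡ monomial m′ n′ [modᵍ 𝔱 ^ᵍ 7 ] → m ≡ m′ × n ≡ n′
monomial-injective = toWitness {a? = all? λ m → all? λ n → all? λ m′ → all? λ n′ →
  monomial m n ≡? monomial m′ n′ [mod𝔱⁷] →-dec (m ≟ m′ ×-dec n ≟ n′)} tt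

monomial-≡-expansion : ∀ m n → monomial m n ≡ expansion m n [modᵍ 𝔱 ^ᵍ 7 ]
monomial-≡-expansion = toWitness {a? = all? λ m → all? λ n →
  monomial m n ≡? expansion m n [mod𝔱⁷]} tt

lemma2p3 : (α : ℤ[i]) → Primary α →
    Σ (Fin 4) (λ m → Σ (Fin 4) (λ n →
      Rep α m n
      × ((m′ n′ : Fin 4) → Rep α m′ n′ → (m′ ≡ m) × (n′ ≡ n))
      × (α ≡ expansion m n [modᵍ 𝔱 ^ᵍ 7 ])))
lemma2p3 α primary =
  let f , g , α≡residue = primary⇒≡primaryResidue α primary
      m , n , residue≡monomial = primaryResidue-≡-monomial f g
      α≡monomial = begin α ≈⟨ α≡residue ⟩ primaryResidue f g ≈⟨ residue≡monomial ⟩ monomial m n ∎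
  in m , n , α≡monomial
   , (λ m′ n′ α≡monomial′ → monomial-injective m′ n′ m n
       (begin monomial m′ n′ ≈⟨ α≡monomial′ ⟨ α ≈⟨ α≡monomial ⟩ monomial m n ∎))
   , (begin α ≈⟨ α≡monomial ⟩ monomial m n ≈⟨ monomial-≡-expansion m n ⟩ expansion m n ∎)
  where open SetoidReasoning (≡[modᵍ]-setoid (𝔱 ^ᵍ 7))
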